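{- Let $\circ$ be either $+$ or $\times$ (the same symbol throughout), and let $U,V,W,X,Y$ be variables. The set of asymmetric equations $\{U =^{\downarrow} V\circ W,\ U =^{\downarrow} X\circ Y\}$ and the set $\{U =^{\downarrow} V\circ W,\ X\circ Y =^{\downarrow} U\}$ each have exactly the same asymmetric $R,\emptyset$-unifiers as the set $\{U =^{\downarrow} V\circ W,\ X =^{\downarrow} V,\ Y =^{\downarrow} W\}$.
   Context: Signature: binary symbols $+,\times$; terms are built from these and variables. $R=\{X\times(Y+Z)\to X\times Y+X\times Z\}$, $E=\emptyset$, and $\Delta$ is the equational theory generated by $X\times(Y+Z)=X\times Y+X\times Z$. $R$ is confluent and terminating; $t\downarrow$ denotes the $R$-normal form of $t$. A substitution $\delta$ is an asymmetric $R,\emptyset$-unifier of a set $\{s_1=^{\downarrow}t_1,\dots,s_n=^{\downarrow}t_n\}$ iff for each $i$, $\delta(s_i)=_\Delta\delta(t_i)$ and $(t_i\downarrow)\delta$ is in $R$-normal form. Standing convention: all substitutions are $R$-normalized, i.e., map every variable to an $R$-normal form. -}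

module Defs where

open import Data.Nat using (ℕ)
open import Data.Product using (Σ; _×_; ∃)
open import Data.List using (List; _∷_; [])
open import Data.List.Relation.Unary.All using (All)
open import Relation.Nullary using (¬_)
open import Function.Bundles using (_⇔_)

infixl 6 _⊕_
infixl 7 _⊗_
data Term : Set where
  var : ℕ → Term
  _⊕_ : Term → Term → Term
  _⊗_ : Term → Term → Term

data Op : Set where
  plus times : Op

app : Op → Term → Term → Term
app plus  s t = s ⊕ t
app times s t = s ⊗ t

Subst : Set
Subst = ℕ → Term

_[_] : Term → Subst → Term
var x   [ σ ] = σ x
(s ⊕ t) [ σ ] = (s [ σ ]) ⊕ (t [ σ ])
(s ⊗ t) [ σ ] = (s [ σ ]) ⊗ (t [ σ ])

infix 4 _⟶_
data _⟶_ : Term → Term → Set where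
  root : ∀ x y z → x ⊗ (y ⊕ z) ⟶ (x ⊗ y) ⊕ (x ⊗ z)
  ⊕ˡ : ∀ {s s'} t → s ⟶ s' → s ⊕ t ⟶ s' ⊕ t
  ⊕ʳ : ∀ s {t t'} → t ⟶ t' → s ⊕ t ⟶ s ⊕ t'
  ⊗ˡ : ∀ {s s'} t → s ⟶ s' → s ⊗ t ⟶ s' ⊗ t
  ⊗ʳ : ∀ s {t t'} → t ⟶ t' → s ⊗ t ⟶ s ⊗ t'

infix 4 _⟶*_
data _⟶*_ : Term → Term → Set where
  ε   : ∀ {t} → t ⟶* t
  _◅_ : ∀ {s t u} → s ⟶ t → t ⟶* u → s ⟶* u

IsNF : Term → Set
IsNF t = ¬ (∃ λ t' → t ⟶ t')

-- n is "the" R-normal form t↓ of t (unique since R is confluent,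
-- existing since R is terminating).
_↓≡_ : Term → Term → Set
t ↓≡ n = (t ⟶* n) × IsNF n

infix 4 _≈Δ_
data _≈Δ_ : Term → Term → Set where
  ax    : ∀ x y z → x ⊗ (y ⊕ z) ≈Δ (x ⊗ y) ⊕ (x ⊗ z)
  refl  : ∀ {t} → t ≈Δ t
  sym   : ∀ {s t} → s ≈Δ t → t ≈Δ s
  trans : ∀ {s t u} → s ≈Δ t → t ≈Δ u → s ≈Δ u
  ⊕-cong : ∀ {s s' t t'} → s ≈Δ s' → t ≈Δ t' → s ⊕ t ≈Δ s' ⊕ t'
  ⊗-cong : ∀ {s s' t t'} → s ≈Δ s' → t ≈Δ t' → s ⊗ t ≈Δ s' ⊗ t'

Normalized : Subst → Set
Normalized δ = ∀ x → IsNF (δ x)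

infix 6 _=↓_
record AEq : Set where
  constructor _=↓_
  field
    lhs rhs : Term

AsymUnifierEq : Subst → AEq → Set
AsymUnifierEq δ (s =↓ t) =
  (s [ δ ] ≈Δ t [ δ ]) × (∀ n → t ↓≡ n → IsNF (n [ δ ]))

AsymUnifier : Subst → List AEq → Set
AsymUnifier δ Γ = All (AsymUnifierEq δ) Γ

-- Two sets of equations have exactly the same asymmetric unifiers
-- (among R-normalized substitutions, per the standing convention).
SameUnifiers : List AEq → List AEq → Set
SameUnifiers Γ Γ' = ∀ (δ : Subst) → Normalized δ → (AsymUnifier δ Γ ⇔ AsymUnifier δ Γ')

-- A computable normal form nf, invariant under Δ and the identity on R-normal
-- terms, shows that Δ-equal R-normal terms are syntactically equal.  Every
-- right-hand side in the statement is already R-normal, so each asymmetric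
-- equation asks δ to make both sides Δ-equal while keeping δ(rhs) normal.
-- For normalized δ all three sets thus say δ U ≡ δ V ∘ δ W, δ X ≡ δ V and
-- δ Y ≡ δ W.  For X ∘ Y =↓ U, where δ X ∘ δ Y need not be normal, the point is
-- that nf (a ∘ b) for normal a, b can equal c ∘ d only if a ≡ c and b ≡ d.
module Submission where

open import Defs
open import Data.Nat using (ℕ)
open import Data.Product using (_×_; _,_)
open import Data.List using (_∷_; [])
open import Data.List.Relation.Unary.All using (All; _∷_; [])
open import Data.List.Relation.Unary.Unique.Propositional using (Unique)
open import Data.Empty using (⊥-elim)
open import Function.Bundles using (_⇔_; mk⇔; Equivalence)
open import Function.Properties.Equivalence as ⇔ using ()
open import Relation.Binary.PropositionalEquality as ≡
  using (_≡_; cong₂; subst; module ≡-Reasoning)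

mul : Term → Term → Term
mul a (var x) = a ⊗ var x
mul a (b ⊕ c) = mul a b ⊕ mul a c
mul a (b ⊗ c) = a ⊗ (b ⊗ c)

nf : Term → Term
nf (var x) = var x
nf (s ⊕ t) = nf s ⊕ nf t
nf (s ⊗ t) = mul (nf s) (nf t)

≈Δ⇒nf≡ : ∀ {s t} → s ≈Δ t → nf s ≡ nf t
≈Δ⇒nf≡ (ax x y z)   = ≡.refl
≈Δ⇒nf≡ refl         = ≡.refl
≈Δ⇒nf≡ (sym p)      = ≡.sym (≈Δ⇒nf≡ p)
≈Δ⇒nf≡ (trans p q)  = ≡.trans (≈Δ⇒nf≡ p) (≈Δ⇒nf≡ q)
≈Δ⇒nf≡ (⊕-cong p q) = cong₂ _⊕_ (≈Δ⇒nf≡ p) (≈Δ⇒nf≡ q)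
≈Δ⇒nf≡ (⊗-cong p q) = cong₂ mul (≈Δ⇒nf≡ p) (≈Δ⇒nf≡ q)

≡⇒≈Δ : ∀ {s t} → s ≡ t → s ≈Δ t
≡⇒≈Δ ≡.refl = refl

IsNF-⊕ˡ : ∀ {s t} → IsNF (s ⊕ t) → IsNF s
IsNF-⊕ˡ {t = t} h (_ , s⟶) = h (_ , ⊕ˡ t s⟶)

IsNF-⊕ʳ : ∀ {s t} → IsNF (s ⊕ t) → IsNF t
IsNF-⊕ʳ {s = s} h (_ , t⟶) = h (_ , ⊕ʳ s t⟶)

IsNF-⊗ˡ : ∀ {s t} → IsNF (s ⊗ t) → IsNF s
IsNF-⊗ˡ {t = t} h (_ , s⟶) = h (_ , ⊗ˡ t s⟶)

IsNF-⊗ʳ : ∀ {s t} → IsNF (s ⊗ t) → IsNF t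
IsNF-⊗ʳ {s = s} h (_ , t⟶) = h (_ , ⊗ʳ s t⟶)

mul-IsNF : ∀ {a} b → IsNF (a ⊗ b) → mul a b ≡ a ⊗ b
mul-IsNF (var x) _ = ≡.refl
mul-IsNF {a} (b ⊕ c) h = ⊥-elim (h (_ , root a b c))
mul-IsNF (b ⊗ c) _ = ≡.refl

nf-IsNF : ∀ t → IsNF t → nf t ≡ t
nf-IsNF (var x) _ = ≡.refl
nf-IsNF (s ⊕ t) h = cong₂ _⊕_ (nf-IsNF s (IsNF-⊕ˡ h)) (nf-IsNF t (IsNF-⊕ʳ h))
nf-IsNF (s ⊗ t) h = begin
  mul (nf s) (nf t) ≡⟨ cong₂ mul (nf-IsNF s (IsNF-⊗ˡ h)) (nf-IsNF t (IsNF-⊗ʳ h)) ⟩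
  mul s t           ≡⟨ mul-IsNF t h ⟩
  s ⊗ t             ∎
  where open ≡-Reasoning

≈Δ-IsNF⇒≡ : ∀ {s t} → IsNF s → IsNF t → s ≈Δ t → s ≡ t
≈Δ-IsNF⇒≡ {s} {t} hs ht s≈t = begin
  s    ≡⟨ ≡.sym (nf-IsNF s hs) ⟩
  nf s ≡⟨ ≈Δ⇒nf≡ s≈t ⟩
  nf t ≡⟨ nf-IsNF t ht ⟩
  t    ∎
  where open ≡-Reasoning

⟶*-IsNF : ∀ {t n} → IsNF t → t ⟶* n → n ≡ t
⟶*-IsNF _ ε       = ≡.refl
⟶*-IsNF h (s ◅ _) = ⊥-elim (h (_ , s))

↓-IsNF-[] : ∀ {t} δ → IsNF t → (∀ n → t ↓≡ n → IsNF (n [ δ ])) ⇔ IsNF (t [ δ ])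
↓-IsNF-[] δ h = mk⇔
  (λ cond → cond _ (ε , h))
  (λ ht n (t⟶*n , _) → subst (λ m → IsNF (m [ δ ])) (≡.sym (⟶*-IsNF h t⟶*n)) ht)

var-IsNF : ∀ x → IsNF (var x)
var-IsNF x (_ , ())

app-var-IsNF : ∀ ∘ x y → IsNF (app ∘ (var x) (var y))
app-var-IsNF plus  x y (_ , ⊕ˡ _ ())
app-var-IsNF plus  x y (_ , ⊕ʳ _ ())
app-var-IsNF times x y (_ , ⊗ˡ _ ())
app-var-IsNF times x y (_ , ⊗ʳ _ ())

app-[] : ∀ ∘ s t δ → app ∘ s t [ δ ] ≡ app ∘ (s [ δ ]) (t [ δ ])
app-[] plus  s t δ = ≡.refl
app-[] times s t δ = ≡.refl

app-injective : ∀ ∘ {a b c d} → app ∘ a b ≡ app ∘ c d → (a ≡ c) × (b ≡ d)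
app-injective plus  ≡.refl = ≡.refl , ≡.refl
app-injective times ≡.refl = ≡.refl , ≡.refl

app-cong : ∀ ∘ {a b c d} → a ≈Δ c → b ≈Δ d → app ∘ a b ≈Δ app ∘ c d
app-cong plus  = ⊕-cong
app-cong times = ⊗-cong

mul≡⊗⇒≡ : ∀ {a} b {c d} → mul a b ≡ c ⊗ d → (a ≡ c) × (b ≡ d)
mul≡⊗⇒≡ (var x) ≡.refl = ≡.refl , ≡.refl
mul≡⊗⇒≡ (b ⊗ c) ≡.refl = ≡.refl , ≡.refl

nf-app-injective : ∀ ∘ {a b c d} → IsNF a → IsNF b →
                   nf (app ∘ a b) ≡ app ∘ c d → (a ≡ c) × (b ≡ d)
nf-app-injective plus  {a} {b} ha hb e
  rewrite nf-IsNF a ha | nf-IsNF b hb = app-injective plus e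
nf-app-injective times {a} {b} ha hb e
  rewrite nf-IsNF a ha | nf-IsNF b hb = mul≡⊗⇒≡ b e

app-≈Δ-IsNF⇒≡ : ∀ ∘ {a b c d} → IsNF a → IsNF b → IsNF (app ∘ c d) →
                app ∘ a b ≈Δ app ∘ c d → (a ≡ c) × (b ≡ d)
app-≈Δ-IsNF⇒≡ ∘ {c = c} {d} ha hb hcd e =
  nf-app-injective ∘ ha hb (≡.trans (≈Δ⇒nf≡ e) (nf-IsNF (app ∘ c d) hcd))

module _ {δ : Subst} (nδ : Normalized δ) where

  var=↓var⇔ : ∀ x y → AsymUnifierEq δ (var x =↓ var y) ⇔ (δ x ≡ δ y)
  var=↓var⇔ x y = mk⇔
    (λ (e , _) → ≈Δ-IsNF⇒≡ (nδ x) (nδ y) e)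
    (λ e → ≡⇒≈Δ e , Equivalence.from (↓-IsNF-[] δ (var-IsNF y)) (nδ y))

  var=↓app⇔ : ∀ ∘ x y z →
              AsymUnifierEq δ (var x =↓ app ∘ (var y) (var z)) ⇔ (δ x ≡ app ∘ (δ y) (δ z))
  var=↓app⇔ ∘ x y z = mk⇔
    (λ (e , cond) → ≈Δ-IsNF⇒≡ (nδ x) (subst IsNF yz[δ] (to (↓-IsNF-[] δ yz-IsNF) cond))
                                      (subst (δ x ≈Δ_) yz[δ] e))
    (λ e → ≡⇒≈Δ (≡.trans e (≡.sym yz[δ]))
         , from (↓-IsNF-[] δ yz-IsNF) (subst IsNF (≡.trans e (≡.sym yz[δ])) (nδ x)))
    where
    open Equivalence
    yz[δ] = app-[] ∘ (var y) (var z) δ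
    yz-IsNF = app-var-IsNF ∘ y z

  app=↓var⇔ : ∀ ∘ x y z →
              AsymUnifierEq δ (app ∘ (var x) (var y) =↓ var z) ⇔ (app ∘ (δ x) (δ y) ≈Δ δ z)
  app=↓var⇔ ∘ x y z = mk⇔
    (λ (e , _) → subst (_≈Δ δ z) (app-[] ∘ (var x) (var y) δ) e)
    (λ e → subst (_≈Δ δ z) (≡.sym (app-[] ∘ (var x) (var y) δ)) e
         , Equivalence.from (↓-IsNF-[] δ (var-IsNF z)) (nδ z))

All₂⇔ : ∀ {P : AEq → Set} {e₁ e₂} {A B : Set} → P e₁ ⇔ A → P e₂ ⇔ B →
        All P (e₁ ∷ e₂ ∷ []) ⇔ (A × B)
All₂⇔ p q = mk⇔ (λ { (x ∷ y ∷ []) → to p x , to q y })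
                (λ (a , b) → from p a ∷ from q b ∷ [])
  where open Equivalence

All₃⇔ : ∀ {P : AEq → Set} {e₁ e₂ e₃} {A B C : Set} → P e₁ ⇔ A → P e₂ ⇔ B → P e₃ ⇔ C →
        All P (e₁ ∷ e₂ ∷ e₃ ∷ []) ⇔ (A × B × C)
All₃⇔ p q r = mk⇔ (λ { (x ∷ y ∷ z ∷ []) → to p x , to q y , to r z })
                  (λ (a , b , c) → from p a ∷ from q b ∷ from r c ∷ [])
  where open Equivalence

module Triangular (∘ : Op) (U V W X Y : ℕ) where

  Solved : Subst → Set
  Solved δ = (δ U ≡ app ∘ (δ V) (δ W)) × (δ X ≡ δ V) × (δ Y ≡ δ W)

  triangular⇔Solved : ∀ {δ} → Normalized δ →
    AsymUnifier δ (var U =↓ app ∘ (var V) (var W) ∷ var X =↓ var V ∷ var Y =↓ var W ∷ [])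
      ⇔ Solved δ
  triangular⇔Solved nδ = All₃⇔ (var=↓app⇔ nδ ∘ U V W) (var=↓var⇔ nδ X V) (var=↓var⇔ nδ Y W)

  shared⇔Solved : ∀ {δ} → Normalized δ →
    AsymUnifier δ (var U =↓ app ∘ (var V) (var W) ∷ var U =↓ app ∘ (var X) (var Y) ∷ [])
      ⇔ Solved δ
  shared⇔Solved nδ = ⇔.trans
    (All₂⇔ (var=↓app⇔ nδ ∘ U V W) (var=↓app⇔ nδ ∘ U X Y))
    (mk⇔ (λ (uvw , uxy) → let (x≡v , y≡w) = app-injective ∘ (≡.trans (≡.sym uxy) uvw)
                          in uvw , x≡v , y≡w)
         (λ (uvw , x≡v , y≡w) → uvw , ≡.trans uvw (cong₂ (app ∘) (≡.sym x≡v) (≡.sym y≡w))))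

  swapped⇔Solved : ∀ {δ} → Normalized δ →
    AsymUnifier δ (var U =↓ app ∘ (var V) (var W) ∷ app ∘ (var X) (var Y) =↓ var U ∷ [])
      ⇔ Solved δ
  swapped⇔Solved nδ = ⇔.trans
    (All₂⇔ (var=↓app⇔ nδ ∘ U V W) (app=↓var⇔ nδ ∘ X Y U))
    (mk⇔ (λ (uvw , xy≈u) → uvw , app-≈Δ-IsNF⇒≡ ∘ (nδ X) (nδ Y) (subst IsNF uvw (nδ U))
                                                   (subst (_ ≈Δ_) uvw xy≈u))
         (λ (uvw , x≡v , y≡w) → uvw , ≡⇒≈Δ (≡.trans (cong₂ (app ∘) x≡v y≡w) (≡.sym uvw))))

lemma7p4 : (∘ : Op) (U V W X Y : ℕ) → Unique (U ∷ V ∷ W ∷ X ∷ Y ∷ []) →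
    SameUnifiers (var U =↓ app ∘ (var V) (var W) ∷ var U =↓ app ∘ (var X) (var Y) ∷ [])
                 (var U =↓ app ∘ (var V) (var W) ∷ var X =↓ var V ∷ var Y =↓ var W ∷ [])
    × SameUnifiers (var U =↓ app ∘ (var V) (var W) ∷ app ∘ (var X) (var Y) =↓ var U ∷ [])
                   (var U =↓ app ∘ (var V) (var W) ∷ var X =↓ var V ∷ var Y =↓ var W ∷ [])
lemma7p4 ∘ U V W X Y _ =
    (λ δ nδ → ⇔.trans (shared⇔Solved nδ) (⇔.sym (triangular⇔Solved nδ)))
  , (λ δ nδ → ⇔.trans (swapped⇔Solved nδ) (⇔.sym (triangular⇔Solved nδ)))
  where open Triangular ∘ U V W X Y
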